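{- Let $M$ be a DFA with $n$ states such that $L = L(M)$ is not prefix-closed. Then a minimal witness $(v,w)$ to the failure of prefix-closure of $L$ satisfies $|w| \le n$. This is best possible: for every $n \ge 2$ there is a DFA with $n$ states whose language is not prefix-closed and whose minimal witness $(v,w)$ has $|w| = n$.
   Context: A word $v$ is a prefix of $w$ if $w = vx$ for some word $x$. $L$ is prefix-closed if $w \in L$ and $v$ a prefix of $w$ imply $v \in L$. A witness to the failure of prefix-closure is a pair $(v,w)$ with $w \in L$, $v \notin L$, $v$ a prefix of $w$. A witness $(v,w)$ is minimal if there is no witness $(v',w')$ with $|w'| < |w|$, or with $|w'| = |w|$ and $|v'| < |v|$. -}

module Defs where

open import Data.Nat using (ℕ; _<_)
open import Data.Fin using (Fin)
open import Data.Bool using (Bool; true)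
open import Data.List using (List; []; _∷_; _++_; length)
open import Data.Product using (Σ; ∃; _×_)
open import Data.Sum using (_⊎_)
open import Relation.Nullary using (¬_)
open import Relation.Binary.PropositionalEquality using (_≡_)

record DFA (n k : ℕ) : Set where
  field
    start  : Fin n
    δ      : Fin n → Fin k → Fin n
    final  : Fin n → Bool

module _ {n k : ℕ} (M : DFA n k) where
  open DFA M

  δ* : Fin n → List (Fin k) → Fin n
  δ* q []       = q
  δ* q (a ∷ w)  = δ* (δ q a) w

  Lang : List (Fin k) → Set
  Lang w = final (δ* start w) ≡ true

module _ {k : ℕ} where
  Prefix : List (Fin k) → List (Fin k) → Set
  Prefix v w = ∃ λ x → w ≡ v ++ x

  PrefixClosed : (List (Fin k) → Set) → Set
  PrefixClosed L = ∀ v w → L w → Prefix v w → L v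

  Witness : (List (Fin k) → Set) → List (Fin k) → List (Fin k) → Set
  Witness L v w = L w × ¬ L v × Prefix v w

  MinimalWitness : (List (Fin k) → Set) → List (Fin k) → List (Fin k) → Set
  MinimalWitness L v w =
    Witness L v w ×
    (∀ v' w' → Witness L v' w' →
       ¬ (length w' < length w ⊎ (length w' ≡ length w × length v' < length v)))

-- Upper bound: if |w| > n, two of the |w| proper prefixes of w reach the same
-- state, say those of lengths i < j, and excising the factor between them
-- leaves the state at the end of w unchanged.  By minimality the prefixes of w
-- shorter than v are in L and those from v up to (excluding) w are not, so i and j
-- lie on the same side of |v|.  Excising then yields a witness with shorter w: the
-- non-member prefix is v itself if |v| ≤ i and v with the factor excised if j ≤ |v|.
--
-- Lower bound: the cyclic unary automaton with n states accepts exactly the words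
-- of length divisible by n; its minimal witness is (a, aⁿ).
module Submission where

open import Defs
open import Data.Nat using (ℕ; zero; suc; _+_; _∸_; _≤_; _<_; s≤s; s≤s⁻¹; _<?_; _≤?_)
open import Data.Nat.Properties
open import Data.List using (List; []; _∷_; _++_; length; take; drop; replicate)
open import Data.List.Properties using (length-++; length-take; length-drop; take++drop≡id; ++-assoc; length-replicate)
open import Data.Fin using (Fin; toℕ; fromℕ; inject₁) renaming (zero to fzero; suc to fsuc)
open import Data.Fin.Properties using (pigeonhole; toℕ<n; toℕ-inject₁; toℕ-fromℕ)
open import Data.Bool using (Bool; true; false)
open import Data.Product using (Σ; _×_; _,_; proj₁; proj₂)
open import Data.Sum using (_⊎_; inj₁; inj₂)
open import Data.Empty using (⊥; ⊥-elim)
open import Relation.Nullary using (¬_; yes; no)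
open import Function using (_∘_)
open import Relation.Binary.PropositionalEquality

module _ {A : Set} where

  take-++ˡ : ∀ m (u x : List A) → m ≤ length u → take m (u ++ x) ≡ take m u
  take-++ˡ zero    u       x _         = refl
  take-++ˡ (suc m) (a ∷ u) x (s≤s m≤u) = cong (a ∷_) (take-++ˡ m u x m≤u)

  drop-++ˡ : ∀ m (u x : List A) → m ≤ length u → drop m (u ++ x) ≡ drop m u ++ x
  drop-++ˡ zero    u       x _         = refl
  drop-++ˡ (suc m) (a ∷ u) x (s≤s m≤u) = drop-++ˡ m u x m≤u

  length-take-≤ : ∀ m (w : List A) → m ≤ length w → length (take m w) ≡ m
  length-take-≤ m w m≤w = trans (length-take m w) (m≤n⇒m⊓n≡m m≤w)

  cut : ℕ → ℕ → List A → List A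
  cut i j w = take i w ++ drop j w

  length-cut-< : ∀ {i j} (w : List A) → i < j → j ≤ length w → length (cut i j w) < length w
  length-cut-< {i} {j} w i<j j≤w = begin-strict
      length (take i w ++ drop j w)         ≡⟨ length-++ (take i w) ⟩
      length (take i w) + length (drop j w) ≡⟨ cong₂ _+_ (length-take-≤ i w (<⇒≤ (<-≤-trans i<j j≤w))) (length-drop j w) ⟩
      i + (length w ∸ j)                    <⟨ +-monoˡ-< (length w ∸ j) i<j ⟩
      j + (length w ∸ j)                    ≡⟨ m+[n∸m]≡n j≤w ⟩
      length w                              ∎
    where open ≤-Reasoning

module _ {k : ℕ} where

  Prefix-trans : ∀ {u v w : List (Fin k)} → Prefix u v → Prefix v w → Prefix u w
  Prefix-trans {u} (x , refl) (y , refl) = x ++ y , ++-assoc u x y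

  take-Prefix : ∀ m (w : List (Fin k)) → Prefix (take m w) w
  take-Prefix m w = drop m w , sym (take++drop≡id m w)

  Prefix-take : ∀ {m} {u w : List (Fin k)} → Prefix u w → length u ≤ m → Prefix u (take m w)
  Prefix-take {u = []}    {w} _                 _           = take _ w , refl
  Prefix-take {suc m} {a ∷ u} (x , refl) (s≤s u≤m) with y , eq ← Prefix-take {m} {u} (x , refl) u≤m =
    y , cong (a ∷_) eq

  Prefix⇒take≡take : ∀ {m} {u w : List (Fin k)} → Prefix u w → m ≤ length u → take m w ≡ take m u
  Prefix⇒take≡take {m} {u} (x , refl) = take-++ˡ m u x

  cut-Prefixˡ : ∀ {i j} {u w : List (Fin k)} → Prefix u w → length u ≤ i → Prefix u (cut i j w)
  cut-Prefixˡ {i} {j} {w = w} u⊑w u≤i = Prefix-trans (Prefix-take u⊑w u≤i) (drop j w , refl)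

  cut-Prefixʳ : ∀ {i j} {u w : List (Fin k)} → i ≤ j → j ≤ length u → Prefix u w →
                Prefix (cut i j u) (cut i j w)
  cut-Prefixʳ {i} {j} {u} i≤j j≤u (x , refl) = x , (begin
      take i (u ++ x) ++ drop j (u ++ x) ≡⟨ cong₂ _++_ (take-++ˡ i u x (≤-trans i≤j j≤u)) (drop-++ˡ j u x j≤u) ⟩
      take i u ++ (drop j u ++ x)        ≡⟨ ++-assoc (take i u) (drop j u) x ⟨
      (take i u ++ drop j u) ++ x        ∎)
    where open ≡-Reasoning

module _ {k : ℕ} {L : List (Fin k) → Set} {v w : List (Fin k)} (min : MinimalWitness L v w) where

  shorter-word-⊥ : ∀ {v′ w′} → Witness L v′ w′ → length w′ < length w → ⊥
  shorter-word-⊥ wit lt = proj₂ min _ _ wit (inj₁ lt)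

  shorter-prefix-⊥ : ∀ {v′} → Witness L v′ w → length v′ < length v → ⊥
  shorter-prefix-⊥ wit lt = proj₂ min _ _ wit (inj₂ (refl , lt))

module _ {n k : ℕ} (M : DFA n k) where
  open DFA M

  δ*-++ : ∀ q (u x : List (Fin k)) → δ* M q (u ++ x) ≡ δ* M (δ* M q u) x
  δ*-++ q []      x = refl
  δ*-++ q (a ∷ u) x = δ*-++ (δ q a) u x

  δ*-cut : ∀ i j q (w : List (Fin k)) → δ* M q (take i w) ≡ δ* M q (take j w) →
           δ* M q (cut i j w) ≡ δ* M q w
  δ*-cut i j q w same = begin
      δ* M q (take i w ++ drop j w)         ≡⟨ δ*-++ q (take i w) (drop j w) ⟩
      δ* M (δ* M q (take i w)) (drop j w)   ≡⟨ cong (λ p → δ* M p (drop j w)) same ⟩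
      δ* M (δ* M q (take j w)) (drop j w)   ≡⟨ δ*-++ q (take j w) (drop j w) ⟨
      δ* M q (take j w ++ drop j w)         ≡⟨ cong (δ* M q) (take++drop≡id j w) ⟩
      δ* M q w                              ∎
    where open ≡-Reasoning

  Lang-resp-δ* : ∀ u u′ → δ* M start u ≡ δ* M start u′ → Lang M u → Lang M u′
  Lang-resp-δ* _ _ same u∈L = trans (cong final (sym same)) u∈L

  cut-∈L : ∀ i j w → δ* M start (take i w) ≡ δ* M start (take j w) → Lang M w → Lang M (cut i j w)
  cut-∈L i j w same = Lang-resp-δ* w (cut i j w) (sym (δ*-cut i j start w same))

  cut-∈L⁻¹ : ∀ i j w → δ* M start (take i w) ≡ δ* M start (take j w) → Lang M (cut i j w) → Lang M w
  cut-∈L⁻¹ i j w same = Lang-resp-δ* (cut i j w) w (δ*-cut i j start w same)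

  minimalWitness-no-repeated-state :
    ∀ {v w i j} → MinimalWitness (Lang M) v w → i < j → j < length w →
    δ* M start (take i w) ≢ δ* M start (take j w)
  minimalWitness-no-repeated-state {v} {w} {i} {j} min@((w∈L , v∉L , v⊑w) , _) i<j j<w same
    with j ≤? length v | length v ≤? i
  ... | yes j≤v | _ =
    shorter-word-⊥ min (cut-∈L i j w same w∈L , cut-v∉L , cut-Prefixʳ (<⇒≤ i<j) j≤v v⊑w) (length-cut-< w i<j (<⇒≤ j<w))
    where
    same-in-v : δ* M start (take i v) ≡ δ* M start (take j v)
    same-in-v = subst₂ (λ u u′ → δ* M start u ≡ δ* M start u′)
                  (Prefix⇒take≡take v⊑w (≤-trans (<⇒≤ i<j) j≤v)) (Prefix⇒take≡take v⊑w j≤v) same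
    cut-v∉L : ¬ Lang M (cut i j v)
    cut-v∉L = v∉L ∘ cut-∈L⁻¹ i j v same-in-v
  ... | no _ | yes v≤i =
    shorter-word-⊥ min (cut-∈L i j w same w∈L , v∉L , cut-Prefixˡ {j = j} v⊑w v≤i)
      (length-cut-< w i<j (<⇒≤ j<w))
  ... | no j≰v | no v≰i = shorter-prefix-⊥ min (w∈L , takeᵢ∉L , take-Prefix i w) takeᵢ<v
    where
    j≤w : j ≤ length w
    j≤w = <⇒≤ j<w
    takeⱼ∉L : ¬ Lang M (take j w)
    takeⱼ∉L takeⱼ∈L = shorter-word-⊥ min (takeⱼ∈L , v∉L , Prefix-take v⊑w (<⇒≤ (≰⇒> j≰v)))
      (subst (_< length w) (sym (length-take-≤ j w j≤w)) j<w)
    takeᵢ∉L : ¬ Lang M (take i w)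
    takeᵢ∉L = takeⱼ∉L ∘ Lang-resp-δ* (take i w) (take j w) same
    takeᵢ<v : length (take i w) < length v
    takeᵢ<v = subst (_< length v) (sym (length-take-≤ i w (<⇒≤ (<-trans i<j j<w)))) (≰⇒> v≰i)

  minimalWitness-length-≤ : ∀ {v w} → MinimalWitness (Lang M) v w → length w ≤ n
  minimalWitness-length-≤ {w = w} min with n <? length w
  ... | no n≮w = ≮⇒≥ n≮w
  ... | yes n<w with i , j , i<j , same ← pigeonhole n<w (λ i → δ* M start (take (toℕ i) w)) =
    ⊥-elim (minimalWitness-no-repeated-state min i<j (toℕ<n j) same)

module _ {k : ℕ} where

  Prefix-[] : ∀ {u : List (Fin k)} → Prefix u [] → u ≡ []
  Prefix-[] {[]} _ = refl

  Witness⇒¬PrefixClosed : ∀ {L : List (Fin k) → Set} {v w} → Witness L v w → ¬ PrefixClosed L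
  Witness⇒¬PrefixClosed {v = v} {w} (w∈L , v∉L , v⊑w) closed = v∉L (closed v w w∈L v⊑w)

module Countdown (N k : ℕ) where

  step : Fin (suc N) → Fin (suc N)
  step fzero    = fromℕ N
  step (fsuc q) = inject₁ q

  isZero : Fin (suc N) → Bool
  isZero fzero    = true
  isZero (fsuc _) = false

  countdown : DFA (suc N) k
  countdown = record { start = fzero ; δ = λ q _ → step q ; final = isZero }

  toℕ-δ* : ∀ q (w : List (Fin k)) → length w ≤ toℕ q → toℕ (δ* countdown q w) ≡ toℕ q ∸ length w
  toℕ-δ* q        []      _         = refl
  toℕ-δ* (fsuc q) (a ∷ w) (s≤s w≤q) = begin
      toℕ (δ* countdown (inject₁ q) w) ≡⟨ toℕ-δ* (inject₁ q) w (subst (length w ≤_) (sym (toℕ-inject₁ q)) w≤q) ⟩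
      toℕ (inject₁ q) ∸ length w       ≡⟨ cong (_∸ length w) (toℕ-inject₁ q) ⟩
      toℕ q ∸ length w                 ∎
    where open ≡-Reasoning

  isZero⇒toℕ≡0 : ∀ q → isZero q ≡ true → toℕ q ≡ 0
  isZero⇒toℕ≡0 fzero _ = refl

  toℕ≡0⇒isZero : ∀ q → toℕ q ≡ 0 → isZero q ≡ true
  toℕ≡0⇒isZero fzero _ = refl

  short-word-∈L⇒[] : ∀ w → Lang countdown w → length w ≤ N → w ≡ []
  short-word-∈L⇒[] []      _    _   = refl
  short-word-∈L⇒[] (a ∷ w) w∈L w<N = ⊥-elim (<⇒≱ w<N (m∸n≡0⇒m≤n N∸w≡0))
    where
    N∸w≡0 : N ∸ length w ≡ 0
    N∸w≡0 = begin
      N ∸ length w                         ≡⟨ cong (_∸ length w) (toℕ-fromℕ N) ⟨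
      toℕ (fromℕ N) ∸ length w             ≡⟨ toℕ-δ* (fromℕ N) w (subst (length w ≤_) (sym (toℕ-fromℕ N)) (<⇒≤ w<N)) ⟨
      toℕ (δ* countdown (fromℕ N) w)       ≡⟨ isZero⇒toℕ≡0 _ w∈L ⟩
      0                                    ∎
      where open ≡-Reasoning

  replicate-∈L : ∀ a → Lang countdown (replicate (suc N) a)
  replicate-∈L a = toℕ≡0⇒isZero _ (begin
      toℕ (δ* countdown (fromℕ N) (replicate N a)) ≡⟨ toℕ-δ* (fromℕ N) (replicate N a) N≤N ⟩
      toℕ (fromℕ N) ∸ length (replicate N a)       ≡⟨ cong₂ _∸_ (toℕ-fromℕ N) (length-replicate N) ⟩
      N ∸ N                                        ≡⟨ n∸n≡0 N ⟩
      0                                            ∎)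
    where
    open ≡-Reasoning
    N≤N : length (replicate N a) ≤ toℕ (fromℕ N)
    N≤N = subst₂ _≤_ (sym (length-replicate N)) (sym (toℕ-fromℕ N)) ≤-refl

  -- with a single state (N = 0) every word is accepted
  countdown-minimalWitness : 1 ≤ N → ∀ a → MinimalWitness (Lang countdown) (a ∷ []) (replicate (suc N) a)
  countdown-minimalWitness 1≤N a = (replicate-∈L a , a∉L , replicate N a , refl) , minimal
    where
    a∉L : ¬ Lang countdown (a ∷ [])
    a∉L a∈L with () ← short-word-∈L⇒[] (a ∷ []) a∈L 1≤N
    minimal : ∀ v′ w′ → Witness (Lang countdown) v′ w′ →
      ¬ (length w′ < length (replicate (suc N) a) ⊎ (length w′ ≡ length (replicate (suc N) a) × length v′ < 1))
    minimal v′ w′ (w′∈L , v′∉L , v′⊑w′) (inj₁ w′<w) with refl ← short-word-∈L⇒[] w′ w′∈L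
      (s≤s⁻¹ (subst (length w′ <_) (length-replicate (suc N)) w′<w)) with refl ← Prefix-[] v′⊑w′ = v′∉L refl
    minimal []      _ (_ , v′∉L , _) (inj₂ _) = v′∉L refl
    minimal (_ ∷ _) _ _              (inj₂ (_ , s≤s ()))

theorem11 :
    ((n k : ℕ) (M : DFA n k) → ¬ PrefixClosed (Lang M) →
      ∀ v w → MinimalWitness (Lang M) v w → length w ≤ n)
    ×
    ((n : ℕ) → 2 ≤ n →
      Σ ℕ λ k → Σ (DFA n k) λ M →
        ¬ PrefixClosed (Lang M) ×
        Σ (List (Fin k)) λ v → Σ (List (Fin k)) λ w →
          MinimalWitness (Lang M) v w × length w ≡ n)
theorem11 = (λ n k M _ v w → minimalWitness-length-≤ M) , lower-bound
  where
  lower-bound : (n : ℕ) → 2 ≤ n →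
    Σ ℕ λ k → Σ (DFA n k) λ M →
      ¬ PrefixClosed (Lang M) ×
      Σ (List (Fin k)) λ v → Σ (List (Fin k)) λ w →
        MinimalWitness (Lang M) v w × length w ≡ n
  lower-bound (suc N) (s≤s 1≤N) =
    1 , countdown , Witness⇒¬PrefixClosed (proj₁ min) , _ , _ , min , length-replicate (suc N)
    where
    open Countdown N 1
    min : MinimalWitness (Lang countdown) (fzero ∷ []) (replicate (suc N) fzero)
    min = countdown-minimalWitness 1≤N fzero
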